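{- Let $\mathcal{F}$ be a finite family of connected graphs, each directed or undirected, and let $\mathcal{P}(\mathcal{F})$ be the family of finite sets $B\subset\mathbb{N}$ that are $\mathcal{F}$-free. Then: $\emptyset\in\mathcal{P}(\mathcal{F})$; (1) if $B\in\mathcal{P}(\mathcal{F})$ and $B'\subseteq B$ then $B'\in\mathcal{P}(\mathcal{F})$; (2) if $T=T_1\sqcup T_2$ is finite and there is no divisibility relation between an element of $T_1$ and an element of $T_2$, then for every $B\subseteq T$, $B\in\mathcal{P}(\mathcal{F})$ if and only if $B\cap T_1\in\mathcal{P}(\mathcal{F})$ and $B\cap T_2\in\mathcal{P}(\mathcal{F})$; (3) for every $m\in\mathbb{N}$ and finite $B\subset\mathbb{N}$, $B\in\mathcal{P}(\mathcal{F})$ if and only if $mB:=\{mb:b\in B\}\in\mathcal{P}(\mathcal{F})$.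
   Context: The divisor graph of a finite set $S\subset\mathbb{N}$ has vertex set $S$ and an edge between $u$ and $v$ whenever $u\neq v$ and one divides the other; each edge is oriented from divisor to multiple ($u\to v$ when $u\mid v$). A graph in $\mathcal{F}$ is called connected if its underlying undirected graph is connected. A finite set $S$ is $\mathcal{F}$-free if its divisor graph contains no copy of any member of $\mathcal{F}$, where containment of a directed member means containment as a (not necessarily induced) directed subgraph of the oriented divisor graph, and containment of an undirected member means containment as a (not necessarily induced) subgraph of the underlying undirected divisor graph. -}

module Defs where

open import Level using (0ℓ)
open import Data.Bool using (Bool; true; false)
open import Data.Nat using (ℕ; _<_; _*_)
open import Data.Nat.Divisibility using (_∣_)
open import Data.Fin using (Fin)
open import Data.Product using (Σ; ∃; _×_; _,_)
open import Data.Sum using (_⊎_)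
open import Data.List using (List)
open import Data.List.Membership.Propositional using (_∈_)
open import Relation.Binary.PropositionalEquality using (_≡_; _≢_)
open import Relation.Unary using (Pred; _⊆_)
open import Function.Definitions using (Injective)

-- A finite graph on vertex set Fin size, given by a list of edges.
-- If 'directed' is true, an edge (i , j) is oriented i → j; otherwise
-- edges are unordered.
record Graph : Set where
  field
    directed : Bool
    size     : ℕ
    edges    : List (Fin size × Fin size)
open Graph public

Adj : (G : Graph) → Fin (size G) → Fin (size G) → Set
Adj G i j = ((i , j) ∈ edges G) ⊎ ((j , i) ∈ edges G)

data Reach (G : Graph) (i : Fin (size G)) : Fin (size G) → Set where
  here : Reach G i i
  step : ∀ {j l} → Reach G i j → Adj G j l → Reach G i l

Connected : Graph → Set
Connected G = (0 < size G) × (∀ i j → Reach G i j)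

NSet : Set₁
NSet = Pred ℕ 0ℓ

EdgeOK : Bool → ℕ → ℕ → Set
EdgeOK true  u v = (u ≢ v) × (u ∣ v)
EdgeOK false u v = (u ≢ v) × ((u ∣ v) ⊎ (v ∣ u))

-- G is contained (not necessarily induced) in the divisor graph of S
Contains : NSet → Graph → Set
Contains S G =
  Σ (Fin (size G) → ℕ) λ φ →
    Injective _≡_ _≡_ φ ×
    (∀ i → S (φ i)) ×
    (∀ {i j} → (i , j) ∈ edges G → EdgeOK (directed G) (φ i) (φ j))

Free : List Graph → NSet → Set
Free 𝓕 S = ∀ {G} → G ∈ 𝓕 → Contains S G → Data.Empty.⊥
  where import Data.Empty

Finite : NSet → Set
Finite S = ∃ λ N → ∀ {x} → S x → x < N

-- ℕ in the paper is the positive integers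
Positive : NSet
Positive x = 0 < x

InP : List Graph → NSet → Set
InP 𝓕 B = Finite B × (B ⊆ Positive) × Free 𝓕 B

dilate : ℕ → NSet → NSet
dilate m B x = ∃ λ b → B b × (x ≡ m * b)

{-# OPTIONS --safe #-}
module Submission where

-- A nonempty graph does not embed into ∅, and freeness passes to subsets. For (2), the image of
-- a connected graph embedded in B ⊆ T₁ ∪ T₂ cannot cross from T₁ to T₂, since every edge
-- joins comparable numbers; so it lies in B ∩ T₁ or in B ∩ T₂. For (3), b ↦ m b with m > 0
-- is injective and preserves and reflects divisibility, so embeddings into B and into mB
-- correspond.

open import Defs
open import Data.Nat using (ℕ; _<_; _+_; _*_; suc; s≤s; NonZero; >-nonZero; >-nonZero⁻¹)
open import Data.Nat.Properties
  using (*-mono-<; *-monoʳ-≤; *-cancelˡ-≡; <⇒≤; <-≤-trans; m≤m+n; m≤n+m)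
open import Data.Nat.Divisibility using (_∣_; *-monoʳ-∣; *-cancelˡ-∣)
open import Data.Bool using (true; false)
open import Data.Fin using (Fin; fromℕ<)
open import Data.Product using (_×_; _,_; proj₁; proj₂; ∃)
import Data.Product as Product
open import Data.Sum using (_⊎_; inj₁; inj₂; [_,_]′)
import Data.Sum as Sum
open import Data.List using (List)
open import Data.List.Membership.Propositional using (_∈_)
open import Data.List.Relation.Unary.All using (All)
import Data.List.Relation.Unary.All as All
open import Data.Empty using (⊥; ⊥-elim)
open import Function using (_∘_)
open import Function.Bundles using (_⇔_; mk⇔; Equivalence)
open import Function.Definitions using (Injective)
open import Relation.Nullary using (¬_)
open import Relation.Unary using (∅; _⊆_; _∩_; _∪_)
open import Relation.Binary.PropositionalEquality using (_≡_; refl; cong; subst₂; module ≡-Reasoning)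
open ≡-Reasoning

private
  variable
    𝓕 : List Graph
    G : Graph
    A B B′ C S T T₁ T₂ : NSet

Finite-mono : A ⊆ C → Finite C → Finite A
Finite-mono A⊆C (N , <N) = N , <N ∘ A⊆C

Finite-∪ : Finite A → Finite C → Finite (A ∪ C)
Finite-∪ (M , <M) (N , <N) =
  M + N , [ (λ a → <-≤-trans (<M a) (m≤m+n M N)) , (λ c → <-≤-trans (<N c) (m≤n+m N M)) ]′

Contains-mono : S ⊆ T → Contains S G → Contains T G
Contains-mono S⊆T (φ , φ-inj , inS , edge) = φ , φ-inj , (λ i → S⊆T (inS i)) , edge

¬Contains-∅ : 0 < size G → ¬ Contains ∅ G
¬Contains-∅ 0<size (φ , _ , in∅ , _) = in∅ (fromℕ< 0<size)

Free-antimono : B′ ⊆ B → Free 𝓕 B → Free 𝓕 B′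
Free-antimono {B′ = B′} {B = B} B′⊆B free G∈𝓕 c = free G∈𝓕 (Contains-mono {S = B′} {T = B} B′⊆B c)

InP-antimono : B′ ⊆ B → InP 𝓕 B → InP 𝓕 B′
InP-antimono {B′ = B′} {B = B} B′⊆B (finite , positive , free) =
  Finite-mono B′⊆B finite , (λ b → positive (B′⊆B b)) , Free-antimono {B′ = B′} {B = B} B′⊆B free

InP-∅ : All Connected 𝓕 → InP 𝓕 ∅
InP-∅ connected =
  (0 , λ ()) , (λ ()) , λ G∈𝓕 → ¬Contains-∅ (proj₁ (All.lookup connected G∈𝓕))

Comparable : ℕ → ℕ → Set
Comparable u v = u ∣ v ⊎ v ∣ u

EdgeOK⇒Comparable : ∀ d {u v} → EdgeOK d u v → Comparable u v
EdgeOK⇒Comparable true  (_ , u∣v) = inj₁ u∣v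
EdgeOK⇒Comparable false (_ , u~v) = u~v

PreservesEdges : (G : Graph) → (Fin (size G) → ℕ) → Set
PreservesEdges G φ = ∀ {i j} → (i , j) ∈ edges G → EdgeOK (directed G) (φ i) (φ j)

Adj⇒Comparable : (φ : Fin (size G) → ℕ) → PreservesEdges G φ →
                 ∀ {i j} → Adj G i j → Comparable (φ i) (φ j)
Adj⇒Comparable {G} φ edge (inj₁ e) = EdgeOK⇒Comparable (directed G) (edge e)
Adj⇒Comparable {G} φ edge (inj₂ e) = Sum.swap (EdgeOK⇒Comparable (directed G) (edge e))

DivClosedIn : NSet → NSet → Set
DivClosedIn B T = ∀ {u v} → T u → B v → Comparable u v → T v

Apart : NSet → NSet → Set
Apart T₁ T₂ = ∀ {x y} → T₁ x → T₂ y → ¬ x ∣ y × ¬ y ∣ x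

Apart-sym : Apart T₁ T₂ → Apart T₂ T₁
Apart-sym apart t₂ t₁ = Product.swap (apart t₁ t₂)

Apart⇒DivClosedIn : B ⊆ T₁ ∪ T₂ → Apart T₁ T₂ → DivClosedIn B T₁
Apart⇒DivClosedIn cover apart t₁u bv u~v with cover bv
... | inj₁ t₁v = t₁v
... | inj₂ t₂v = let (u∤v , v∤u) = apart t₁u t₂v in ⊥-elim ([ u∤v , v∤u ]′ u~v)

Reach-closed : DivClosedIn B T → (φ : Fin (size G) → ℕ) → (∀ i → B (φ i)) →
               PreservesEdges G φ → ∀ {i j} → T (φ i) → Reach G i j → T (φ j)
Reach-closed closed φ inB edge t here       = t
Reach-closed closed φ inB edge t (step r a) =
  closed (Reach-closed closed φ inB edge t r) (inB _) (Adj⇒Comparable φ edge a)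

Contains-restrict : Connected G → DivClosedIn B T → (c : Contains B G) →
                    ∀ i → T (proj₁ c i) → Contains (B ∩ T) G
Contains-restrict (_ , reach) closed (φ , φ-inj , inB , edge) i t =
  φ , φ-inj , (λ j → inB j , Reach-closed closed φ inB edge t (reach i j)) , edge

Contains-split : Connected G → B ⊆ T₁ ∪ T₂ → Apart T₁ T₂ → Contains B G →
                 Contains (B ∩ T₁) G ⊎ Contains (B ∩ T₂) G
Contains-split {G = G} {B = B} {T₁ = T₁} {T₂ = T₂}
               connected@(0<size , _) cover apart c@(_ , _ , inB , _) =
  Sum.map (Contains-restrict connected closed₁ c root)
          (Contains-restrict connected closed₂ c root)
          (cover (inB root))
  where
  root : Fin (size G)
  root = fromℕ< 0<size

  closed₁ : DivClosedIn B T₁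
  closed₁ = Apart⇒DivClosedIn cover apart

  closed₂ : DivClosedIn B T₂
  closed₂ = Apart⇒DivClosedIn (Sum.swap ∘ cover) (Apart-sym apart)

InP-split : All Connected 𝓕 → B ⊆ T₁ ∪ T₂ → Apart T₁ T₂ →
            InP 𝓕 (B ∩ T₁) → InP 𝓕 (B ∩ T₂) → InP 𝓕 B
InP-split {B = B} {T₁} {T₂} connected cover apart
          (finite₁ , positive₁ , free₁) (finite₂ , positive₂ , free₂) =
  Finite-mono B⊆parts (Finite-∪ finite₁ finite₂) ,
  [ positive₁ , positive₂ ]′ ∘ B⊆parts ,
  λ G∈𝓕 → [ free₁ G∈𝓕 , free₂ G∈𝓕 ]′ ∘ Contains-split (All.lookup connected G∈𝓕) cover apart
  where
  B⊆parts : B ⊆ (B ∩ T₁) ∪ (B ∩ T₂)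
  B⊆parts b = Sum.map (b ,_) (b ,_) (cover b)

image : (ℕ → ℕ) → NSet → NSet
image f S x = ∃ λ b → S b × x ≡ f b

EdgeOK-map : ∀ d {u v u′ v′} → (u′ ≡ v′ → u ≡ v) → (u ∣ v → u′ ∣ v′) → (v ∣ u → v′ ∣ u′) →
             EdgeOK d u v → EdgeOK d u′ v′
EdgeOK-map true  reflects-≡ f g (u≢v , u∣v) = u≢v ∘ reflects-≡ , f u∣v
EdgeOK-map false reflects-≡ f g (u≢v , u~v) = u≢v ∘ reflects-≡ , Sum.map f g u~v

module _ (f : ℕ → ℕ) where

  Contains-image : Injective _≡_ _≡_ f → (∀ {u v} → u ∣ v → f u ∣ f v) →
                   Contains S G → Contains (image f S) G
  Contains-image f-inj f-mono (φ , φ-inj , inS , edge) =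
    f ∘ φ , φ-inj ∘ f-inj , (λ i → φ i , inS i , refl) ,
    EdgeOK-map _ f-inj f-mono f-mono ∘ edge

  Contains-preimage : (∀ {u v} → f u ∣ f v → u ∣ v) → Contains (image f S) G → Contains S G
  Contains-preimage {S = S} {G = G} f-reflects (φ , φ-inj , inImage , edge) = ψ , ψ-inj , inS , edge′
    where
    ψ : Fin (size G) → ℕ
    ψ i = proj₁ (inImage i)

    φ≡fψ : ∀ i → φ i ≡ f (ψ i)
    φ≡fψ i = proj₂ (proj₂ (inImage i))

    ψ-inj : Injective _≡_ _≡_ ψ
    ψ-inj {i} {j} ψi≡ψj = φ-inj (begin
      φ i     ≡⟨ φ≡fψ i ⟩
      f (ψ i) ≡⟨ cong f ψi≡ψj ⟩
      f (ψ j) ≡⟨ φ≡fψ j ⟨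
      φ j     ∎)

    inS : ∀ i → S (ψ i)
    inS i = proj₁ (proj₂ (inImage i))

    edge′ : PreservesEdges G ψ
    edge′ e = EdgeOK-map _ (cong f) f-reflects f-reflects
                (subst₂ (EdgeOK (directed G)) (φ≡fψ _) (φ≡fψ _) (edge e))

  Free-image⇔ : Injective _≡_ _≡_ f → (∀ {u v} → u ∣ v → f u ∣ f v) →
                (∀ {u v} → f u ∣ f v → u ∣ v) → Free 𝓕 S ⇔ Free 𝓕 (image f S)
  Free-image⇔ f-inj f-mono f-reflects = mk⇔
    (λ free {_} G∈𝓕 → free G∈𝓕 ∘ Contains-preimage f-reflects)
    (λ free {_} G∈𝓕 → free G∈𝓕 ∘ Contains-image f-inj f-mono)

Finite-dilate : ∀ m → Finite B → Finite (dilate m B)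
Finite-dilate m (N , <N) = suc (m * N) , λ { (b , Bb , refl) → s≤s (*-monoʳ-≤ m (<⇒≤ (<N Bb))) }

Positive-dilate : ∀ m .{{_ : NonZero m}} → B ⊆ Positive → dilate m B ⊆ Positive
Positive-dilate m positive (b , Bb , refl) = *-mono-< {0} {m} {0} {b} (>-nonZero⁻¹ m) (positive Bb)

InP-dilate⇔ : ∀ m .{{_ : NonZero m}} → Finite B → B ⊆ Positive → InP 𝓕 B ⇔ InP 𝓕 (dilate m B)
InP-dilate⇔ m finite positive = mk⇔
  (λ (_ , _ , free) → Finite-dilate m finite , Positive-dilate m positive , Equivalence.to free-dilate free)
  (λ (_ , _ , free) → finite , positive , Equivalence.from free-dilate free)
  where
  free-dilate : Free 𝓕 B ⇔ Free 𝓕 (dilate m B)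
  free-dilate = Free-image⇔ (m *_) (*-cancelˡ-≡ _ _ m) (*-monoʳ-∣ m) (*-cancelˡ-∣ m)

proposition4p1 :
    (𝓕 : List Graph) → All Connected 𝓕 →
    InP 𝓕 ∅
    × (∀ (B B′ : NSet) → InP 𝓕 B → B′ ⊆ B → InP 𝓕 B′)
    × (∀ (T₁ T₂ : NSet) → Finite T₁ → Finite T₂ → T₁ ⊆ Positive → T₂ ⊆ Positive →
         (∀ {x} → T₁ x → T₂ x → ⊥) →
         (∀ {x y} → T₁ x → T₂ y → (x ∣ y → ⊥) × (y ∣ x → ⊥)) →
         ∀ (B : NSet) → B ⊆ (T₁ ∪ T₂) →
         InP 𝓕 B ⇔ (InP 𝓕 (B ∩ T₁) × InP 𝓕 (B ∩ T₂)))
    × (∀ (m : ℕ) → 0 < m → ∀ (B : NSet) → Finite B → B ⊆ Positive →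
         InP 𝓕 B ⇔ InP 𝓕 (dilate m B))
proposition4p1 𝓕 connected =
  InP-∅ connected ,
  (λ B B′ inP B′⊆B → InP-antimono B′⊆B inP) ,
  (λ T₁ T₂ _ _ _ _ _ apart B cover → mk⇔
    (λ inP → InP-antimono proj₁ inP , InP-antimono proj₁ inP)
    (λ (inP₁ , inP₂) → InP-split connected cover apart inP₁ inP₂)) ,
  λ m 0<m B → InP-dilate⇔ m {{>-nonZero 0<m}}
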